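{- Let $\mathbf A\in\mathcal S$ satisfy $x'\approx x\to x$ and $0'\approx 0$. Then $\mathbf A$ satisfies $x'\approx x$.
   Context: A zroupoid is an algebra $\langle A,\to,0\rangle$ with $\to$ binary and $0$ a constant; write $x' := x\to 0$. An implication zroupoid ($\mathcal I$-zroupoid) is a zroupoid satisfying (I) $(x\to y)\to z \approx ((z'\to x)\to(y\to z)')'$ and (I$_0$) $0''\approx 0$. $\mathcal S$ is the variety of $\mathcal I$-zroupoids satisfying $x''\approx x$ and $(x\to y')'\approx (y\to x')'$. -}

module Defs where

open import Level using (Level; suc)
open import Relation.Binary.PropositionalEquality using (_≡_)

record Zroupoid (a : Level) : Set (suc a) where
  infixr 5 _⇒_
  field
    Carrier : Set a
    _⇒_     : Carrier → Carrier → Carrier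
    𝟘       : Carrier

  _′ : Carrier → Carrier
  x ′ = x ⇒ 𝟘

module _ {a : Level} (A : Zroupoid a) where
  open Zroupoid A

  SatisfiesI : Set a
  SatisfiesI = ∀ x y z → ((x ⇒ y) ⇒ z) ≡ (((z ′ ⇒ x) ⇒ ((y ⇒ z) ′)) ′)

  SatisfiesI₀ : Set a
  SatisfiesI₀ = ((𝟘 ′) ′) ≡ 𝟘

  record IsIZroupoid : Set a where
    field
      axI  : SatisfiesI
      axI₀ : SatisfiesI₀

  record InS : Set a where
    field
      isI      : IsIZroupoid
      dblNeg   : ∀ x → ((x ′) ′) ≡ x
      symm     : ∀ x y → ((x ⇒ (y ′)) ′) ≡ ((y ⇒ (x ′)) ′)

module Submission where

open import Defs
open import Level using (Level)
open import Relation.Binary.PropositionalEquality using (_≡_; sym; cong)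
open Relation.Binary.PropositionalEquality.≡-Reasoning

-- Only axiom (I), the involution law x'' ≈ x and 0' ≈ 0 are
-- needed.
--   * 0 is a left identity: instantiating (I) at (y, 0, 0) and using
--     0' ≈ 0 turns y ≈ y'' into (0 → y)'' ≈ 0 → y.
--   * Hence x → x ≈ (0 → x) → x, and (I) at (0, x, x) rewrites this as
--     (x'' → (x → x)')' ≈ (x → (x → x)')'.
--   * With x' ≈ x → x this reads x' ≈ (x → x'')' ≈ (x → x)' ≈ x'' ≈ x.

module _ {a : Level} (A : Zroupoid a) where
  open Zroupoid A

  zero-leftIdentity : SatisfiesI A → (∀ x → (x ′) ′ ≡ x) → 𝟘 ′ ≡ 𝟘
                    → ∀ y → 𝟘 ⇒ y ≡ y
  zero-leftIdentity axI dblNeg z0 y = sym (begin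
    y                                   ≡⟨ sym (dblNeg y) ⟩
    (y ′) ′                             ≡⟨ axI y 𝟘 𝟘 ⟩
    ((𝟘 ′ ⇒ y) ⇒ ((𝟘 ⇒ 𝟘) ′)) ′         ≡⟨ cong (λ t → ((t ⇒ y) ⇒ (t ′)) ′) z0 ⟩
    ((𝟘 ⇒ y) ⇒ (𝟘 ′)) ′                 ≡⟨ cong (λ t → ((𝟘 ⇒ y) ⇒ t) ′) z0 ⟩
    ((𝟘 ⇒ y) ′) ′                       ≡⟨ dblNeg _ ⟩
    𝟘 ⇒ y                               ∎)

  selfImplication : SatisfiesI A → (∀ x → (x ′) ′ ≡ x) → 𝟘 ′ ≡ 𝟘
                  → ∀ x → x ⇒ x ≡ (x ⇒ ((x ⇒ x) ′)) ′
  selfImplication axI dblNeg z0 x = begin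
    x ⇒ x                               ≡⟨ cong (_⇒ x) (sym (zero-leftIdentity axI dblNeg z0 x)) ⟩
    (𝟘 ⇒ x) ⇒ x                         ≡⟨ axI 𝟘 x x ⟩
    (((x ′) ⇒ 𝟘) ⇒ ((x ⇒ x) ′)) ′       ≡⟨ cong (λ t → (t ⇒ ((x ⇒ x) ′)) ′) (dblNeg x) ⟩
    (x ⇒ ((x ⇒ x) ′)) ′                 ∎

lemma3p3 : {a : Level} (A : Zroupoid a) → InS A
    → (∀ x → Zroupoid._′ A x ≡ Zroupoid._⇒_ A x x)
    → Zroupoid._′ A (Zroupoid.𝟘 A) ≡ Zroupoid.𝟘 A
    → ∀ x → Zroupoid._′ A x ≡ x
lemma3p3 A s negIsSelf z0 x = begin
  x ′                         ≡⟨ negIsSelf x ⟩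
  x ⇒ x                       ≡⟨ selfImplication A axI dblNeg z0 x ⟩
  (x ⇒ ((x ⇒ x) ′)) ′         ≡⟨ cong (λ t → (x ⇒ (t ′)) ′) (sym (negIsSelf x)) ⟩
  (x ⇒ ((x ′) ′)) ′           ≡⟨ cong (λ t → (x ⇒ t) ′) (dblNeg x) ⟩
  (x ⇒ x) ′                   ≡⟨ cong _′ (sym (negIsSelf x)) ⟩
  (x ′) ′                     ≡⟨ dblNeg x ⟩
  x                           ∎
  where
  open Zroupoid A
  open InS s
  open IsIZroupoid isI
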